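{- Let $m,n\ge1$, $i,j\in\mathbb Z$, and let $\Pi=\{(i_k,j_k)\}_{k=0}^{m+n}$ be a lattice path from $(i,j)$ to $(i+m,j+n)$. Let $u_{i_k,j_k}$ ($k=0,\dots,m+n$) be positive integers with $u_{i,j}=u_{i+m,j+n}$; extend $\Pi$ and these values periodically by $(i_{k+m+n},j_{k+m+n})=(i_k+m,j_k+n)$ and $u_{i_k+m,j_k+n}=u_{i_k,j_k}$. (1) If all $u_{i_k,j_k}=1$, then there is a unique positive integral $(m,n)$-periodic $SL_2$-tiling whose entries at the positions $(i_k,j_k)$ are the given values. (2) Suppose that for each $k=1,\dots,m+n$: if $i_{k+1}-i_{k-1}$ is even then $\frac{u_{i_{k+1},j_{k+1}}+u_{i_{k-1},j_{k-1}}}{u_{i_k,j_k}}\in\mathbb Z$, and if $i_{k+1}-i_{k-1}$ is odd then $\frac{u_{i_{k+1},j_{k+1}}\,u_{i_{k-1},j_{k-1}}+1}{u_{i_k,j_k}}\in\mathbb Z$. Then there is a unique positive integral $(m,n)$-periodic $SL_2$-tiling whose entries at the positions $(i_k,j_k)$ are the given values.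
   Context: A lattice path from $(a,b)$ to $(c,d)$ ($a<c$, $b<d$) is a sequence $(i_k,j_k)_{k=0}^{c-a+d-b}$ with $(i_0,j_0)=(a,b)$, last term $(c,d)$, and each $(i_{k+1},j_{k+1})$ equal to $(i_k,j_k+1)$ or $(i_k+1,j_k)$. An $SL_2$-tiling is a family $(u_{i,j})_{i,j\in\mathbb Z}$ of reals with $u_{i+1,j}u_{i,j+1}-u_{i,j}u_{i+1,j+1}=1$ for all $i,j$; positive integral if all entries are positive integers; $(m,n)$-periodic if $u_{i+m,j+n}=u_{i,j}$ for all $i,j$. -}

module Defs where

open import Data.Nat as ℕ using (ℕ; zero; suc; _%_; _/_)
open import Data.Integer as ℤ using (ℤ; +_; _+_; _-_; _*_; _<_)
open import Data.Integer.Divisibility using (_∣_)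
open import Data.Product using (_×_; _,_; proj₁; proj₂; Σ; ∃)
open import Data.Sum using (_⊎_)
open import Relation.Binary.PropositionalEquality using (_≡_)
open import Relation.Nullary using (¬_)

Point : Set
Point = ℤ × ℤ

Step : Point → Point → Set
Step (a , b) q = (q ≡ (a , b + + 1)) ⊎ (q ≡ (a + + 1 , b))

IsLatticePath : ℕ → ℕ → ℤ → ℤ → (ℕ → Point) → Set
IsLatticePath m n i j π =
  (π 0 ≡ (i , j)) × (π (m ℕ.+ n) ≡ (i + + m , j + + n)) ×
  (∀ k → k ℕ.< m ℕ.+ n → Step (π k) (π (suc k)))

extPos : ℕ → ℕ → (ℕ → Point) → ℕ → Point
extPos m n π k with m ℕ.+ n
... | zero = π k
... | suc N' = let q = k / suc N' ; r = k % suc N'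
                in (proj₁ (π r) + + (q ℕ.* m) , proj₂ (π r) + + (q ℕ.* n))

extVal : ℕ → ℕ → (ℕ → ℕ) → ℕ → ℕ
extVal m n v k with m ℕ.+ n
... | zero = v k
... | suc N' = v (k % suc N')

IsSL2Tiling : (ℤ → ℤ → ℤ) → Set
IsSL2Tiling u = ∀ i j →
  u (i + + 1) j * u i (j + + 1) - u i j * u (i + + 1) (j + + 1) ≡ + 1

IsPositive : (ℤ → ℤ → ℤ) → Set
IsPositive u = ∀ i j → + 0 < u i j

IsPeriodic : ℕ → ℕ → (ℤ → ℤ → ℤ) → Set
IsPeriodic m n u = ∀ i j → u (i + + m) (j + + n) ≡ u i j

IsSolution : ℕ → ℕ → (ℕ → Point) → (ℕ → ℕ) → (ℤ → ℤ → ℤ) → Set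
IsSolution m n π v u =
  IsSL2Tiling u × IsPositive u × IsPeriodic m n u ×
  (∀ k → k ℕ.≤ m ℕ.+ n → u (proj₁ (π k)) (proj₂ (π k)) ≡ + v k)

UniqueSolution : ℕ → ℕ → (ℕ → Point) → (ℕ → ℕ) → Set
UniqueSolution m n π v =
  Σ (ℤ → ℤ → ℤ) λ u → IsSolution m n π v u ×
    (∀ u' → IsSolution m n π v u' → ∀ a b → u' a b ≡ u a b)

DivCondition : ℕ → ℕ → (ℕ → Point) → (ℕ → ℕ) → Set
DivCondition m n π v = ∀ k → 1 ℕ.≤ k → k ℕ.≤ m ℕ.+ n →
  let P = extPos m n π ; U = λ t → + extVal m n v t
      d = proj₁ (P (suc k)) - proj₁ (P (k ℕ.∸ 1))
  in ((+ 2 ∣ d) → U k ∣ (U (suc k) + U (k ℕ.∸ 1))) ×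
     (¬ (+ 2 ∣ d) → U k ∣ (U (suc k) * U (k ℕ.∸ 1) + + 1))

{-# OPTIONS --safe #-}
module Submission where

-- Measure positions by their antidiagonal k and their offset T from the path along it.  The SL₂
-- relation on a unit square then computes the entry at offset t + 1 from three entries nearer to the
-- path, so a tiling is determined by its values on the path, and it exists as soon as every one of
-- these divisions is exact.  Exactness comes from an invariant: along every lattice path through
-- entries already computed, a value y with neighbours x and z divides x + z when the two adjacent
-- steps have the same direction and x z + 1 otherwise.  This is the hypothesis of (2) for the given
-- path; it survives flipping a corner of a path across its unit square, because the SL₂ relation
-- z c = 1 + y r there makes z an inverse of c modulo y; and the division producing a new entry takes
-- place at such a corner.  Periodicity follows from uniqueness, since the translated tiling has the
-- same values on the periodic path, and (1) is the case where all values are 1.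

open import Defs
open import Data.Bool using (Bool; true; false; not; if_then_else_)
import Data.Bool.Properties as Bool
open import Data.Empty using (⊥-elim)
open import Data.Integer as ℤ using (ℤ; +_; -[1+_]; 0ℤ; 1ℤ; -1ℤ) renaming (suc to sucℤ; pred to predℤ)
import Data.Integer.Properties as ℤ
open import Data.Integer.DivMod using (_%ℕ_; _/ℕ_; n%ℕd<d; a≡a%ℕn+[a/ℕn]*n)
open import Data.Integer.Divisibility using () renaming (_∣_ to _∣ℤ_)
open import Data.Integer.Tactic.RingSolver using (solve-∀)
open import Data.Nat as ℕ using (ℕ; zero; suc; _≤_; _<_; z≤n; s≤s)
import Data.Nat.Properties as ℕ
open import Data.Nat.Coprimality using (Coprime; coprime-divisor)
open import Data.Nat.Divisibility
  using (_∣_; divides; ∣-refl; _∣0; 1∣_;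
         ∣1⇒≡1; ∣m+n∣m⇒∣n; ∣m∣n⇒∣m+n; ∣m⇒∣m*n; ∣n⇒∣m*n; m∣m*n)
open import Data.Nat.DivMod
  using (_/_; _%_; m/n*n≡m; m≡m%n+[m/n]*n; [m+kn]%n≡m%n; [m+n]%n≡m%n; m<n⇒m%n≡m; n%n≡0; m%n<n)
import Data.Nat.Tactic.RingSolver as ℕ-Solver
open import Data.Product using (Σ; ∃-syntax; _×_; _,_; proj₁; proj₂; uncurry)
open import Data.Sum using (inj₁; inj₂)
open import Function using (id)
open import Relation.Binary.PropositionalEquality
open import Relation.Nullary using (¬_; does; yes; no; contradiction)

-- Steps and the divisibility rule

-- A step of a lattice path is true for (i , j) → (i + 1 , j) and false for (i , j) → (i , j + 1).
Δi : Bool → ℕ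
Δi true = 1
Δi false = 0

-- i_{k+1} − i_{k−1} = Δi a + Δi b is even exactly when a ≡ b.
DivRule : Bool → Bool → ℕ → ℕ → ℕ → Set
DivRule true  true  x y z = y ∣ x ℕ.+ z
DivRule false false x y z = y ∣ x ℕ.+ z
DivRule _     _     x y z = y ∣ x ℕ.* z ℕ.+ 1

DivRule-not : ∀ {a b x y z} → DivRule a b x y z → DivRule (not a) (not b) x y z
DivRule-not {true}  {true}  d = d
DivRule-not {true}  {false} d = d
DivRule-not {false} {true}  d = d
DivRule-not {false} {false} d = d

-- The hypothesis says that z is an inverse of c modulo y.
module _ {x y z c r : ℕ} (zc≡1+yr : z ℕ.* c ≡ 1 ℕ.+ y ℕ.* r) where
  open import Data.Nat using (_+_; _*_)

  coprime-of-inverse : Coprime y c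
  coprime-of-inverse {d} (d∣y , d∣c) = ∣1⇒≡1 (∣m+n∣m⇒∣n d∣yr+1 (∣m⇒∣m*n r d∣y))
    where
    d∣yr+1 : d ∣ y * r + 1
    d∣yr+1 = subst (d ∣_) (trans zc≡1+yr (ℕ.+-comm 1 (y * r))) (∣n⇒∣m*n z d∣c)

  ∣*+1⇒∣+inverse : y ∣ x * c + 1 → y ∣ x + z
  ∣*+1⇒∣+inverse y∣xc+1 =
    coprime-divisor coprime-of-inverse (subst (y ∣_) (sym c[x+z]) (∣m∣n⇒∣m+n y∣xc+1 (m∣m*n r)))
    where
    open ≡-Reasoning
    c[x+z] : c * (x + z) ≡ x * c + 1 + y * r
    c[x+z] = begin
      c * (x + z)         ≡⟨ lemma x z c ⟩
      x * c + z * c       ≡⟨ cong (_+_ (x * c)) zc≡1+yr ⟩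
      x * c + (1 + y * r) ≡⟨ ℕ.+-assoc (x * c) 1 (y * r) ⟨
      x * c + 1 + y * r   ∎
      where
      lemma : ∀ x z c → c * (x + z) ≡ x * c + z * c
      lemma = ℕ-Solver.solve-∀

  ∣+⇒∣*inverse+1 : y ∣ x + c → y ∣ x * z + 1
  ∣+⇒∣*inverse+1 y∣x+c = ∣m+n∣m⇒∣n (subst (y ∣_) [x+c]z (∣m⇒∣m*n z y∣x+c)) (m∣m*n r)
    where
    open ≡-Reasoning
    [x+c]z : (x + c) * z ≡ y * r + (x * z + 1)
    [x+c]z = begin
      (x + c) * z           ≡⟨ lemma x c z ⟩
      x * z + z * c         ≡⟨ cong (_+_ (x * z)) zc≡1+yr ⟩
      x * z + (1 + y * r)   ≡⟨ lemma′ (x * z) (y * r) ⟩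
      y * r + (x * z + 1)   ∎
      where
      lemma : ∀ x c z → (x + c) * z ≡ x * z + z * c
      lemma = ℕ-Solver.solve-∀
      lemma′ : ∀ a b → a + (1 + b) ≡ b + (a + 1)
      lemma′ = ℕ-Solver.solve-∀

-- Propagation from a path to one side

-- The junk value x /₀ 0 = 0 never occurs: all entries are positive.
infixl 7 _/₀_
_/₀_ : ℕ → ℕ → ℕ
x /₀ zero  = 0
x /₀ suc y = x / suc y

-- W k t is the entry at offset t ≥ 0 from a path on the antidiagonal k, on one side of the path;
-- σ k is the kind of the path's step from antidiagonal k to k + 1, and V k its value there.
module HalfTiling
  (σ : ℤ → Bool) (V : ℤ → ℕ) (V-pos : ∀ k → 1 ≤ V k)
  (V-divRule : ∀ k → DivRule (σ (predℤ k)) (σ k) (V (predℤ k)) (V k) (V (sucℤ k)))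
  (true-leftwards : ∀ k → ∃[ r ] σ (k ℤ.- + r) ≡ true)
  (false-rightwards : ∀ k → ∃[ r ] σ (k ℤ.+ + r) ≡ false)
  where
  open import Data.Nat using (_+_; _*_)

  prevOffset nextOffset : ℤ → ℕ → ℕ
  prevOffset k t = if σ (predℤ k) then t else suc t
  nextOffset k t = if σ k then suc t else t

  -- Bove–Capretta domain of W: computing offset t + 1 may need offset t + 1 on a neighbouring
  -- antidiagonal, and this chain stops at the nearest i-step to the left or j-step to the right.
  data Dom : ℤ → ℕ → Set where
    base : ∀ {k} → Dom k 0
    step : ∀ {k t} → Dom (predℤ k) (prevOffset k t) → Dom k t → Dom (sucℤ k) (nextOffset k t) →
           Dom k (suc t)

  value : ∀ {k t} → Dom k t → ℕ
  value {k} base = V k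
  value (step p c n) = (1 + value p * value n) /₀ value c

  value-irrelevant : ∀ {k t} (d d′ : Dom k t) → value d ≡ value d′
  value-irrelevant base base = refl
  value-irrelevant (step p c n) (step p′ c′ n′) =
    cong₂ _/₀_ (cong₂ (λ a b → 1 + a * b) (value-irrelevant p p′) (value-irrelevant n n′))
               (value-irrelevant c c′)

  module _ (t : ℕ) (dom-t : ∀ k → Dom k t) where

    dom-prev : ∀ r k → σ (predℤ k ℤ.- + r) ≡ true → Dom (predℤ k) (prevOffset k t)
    dom-prev zero k σ≡true =
      subst (λ b → Dom _ (if b then t else suc t))
            (sym (trans (cong σ (sym (ℤ.+-identityʳ (predℤ k)))) σ≡true)) (dom-t _)
    dom-prev (suc r) k σ≡true with σ (predℤ k) in σ[k-1]
    ... | true  = dom-t (predℤ k)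
    ... | false = step (dom-prev r (predℤ k) (trans (cong σ (pred-shift k (+ r))) σ≡true))
                       (dom-t (predℤ k))
                       (subst (λ b → Dom _ (if b then suc t else t)) (sym σ[k-1]) (dom-t _))
      where
      pred-shift : ∀ k r → (-1ℤ ℤ.+ (-1ℤ ℤ.+ k)) ℤ.- r ≡ (-1ℤ ℤ.+ k) ℤ.- (1ℤ ℤ.+ r)
      pred-shift = solve-∀

    dom-next : ∀ r k → σ (k ℤ.+ + r) ≡ false → Dom (sucℤ k) (nextOffset k t)
    dom-next zero k σ≡false =
      subst (λ b → Dom _ (if b then suc t else t))
            (sym (trans (cong σ (sym (ℤ.+-identityʳ k))) σ≡false)) (dom-t _)
    dom-next (suc r) k σ≡false with σ k in σ[k]
    ... | false = dom-t (sucℤ k)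
    ... | true  = step (subst (λ b → Dom _ (if b then t else suc t))
                              (sym (trans (cong σ (ℤ.pred-suc k)) σ[k])) (dom-t _))
                       (dom-t (sucℤ k))
                       (dom-next r (sucℤ k) (trans (cong σ (suc-shift k (+ r))) σ≡false))
      where
      suc-shift : ∀ k r → (1ℤ ℤ.+ k) ℤ.+ r ≡ k ℤ.+ (1ℤ ℤ.+ r)
      suc-shift = solve-∀

  dom : ∀ t k → Dom k t
  dom-prevOffset : ∀ t k → Dom (predℤ k) (prevOffset k t)
  dom-nextOffset : ∀ t k → Dom (sucℤ k) (nextOffset k t)
  dom zero    k = base
  dom (suc t) k = step (dom-prevOffset t k) (dom t k) (dom-nextOffset t k)
  dom-prevOffset t k = dom-prev t (dom t) _ k (proj₂ (true-leftwards (predℤ k)))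
  dom-nextOffset t k = dom-next t (dom t) _ k (proj₂ (false-rightwards k))

  W : ℤ → ℕ → ℕ
  W k t = value (dom t k)

  W-step : ∀ k t →
    W k (suc t) ≡ (1 + W (predℤ k) (prevOffset k t) * W (sucℤ k) (nextOffset k t)) /₀ W k t
  W-step k t = cong₂ (λ a b → (1 + a * b) /₀ W k t)
    (value-irrelevant (dom-prevOffset t k) (dom _ _)) (value-irrelevant (dom-nextOffset t k) (dom _ _))

  Diamond : ℤ → ℕ → Set
  Diamond k t =
    W k (suc t) * W k t ≡ 1 + W (predℤ k) (prevOffset k t) * W (sucℤ k) (nextOffset k t)

  data Valid : ℤ → ℕ → Set where
    base : ∀ {k} → Valid k 0
    step : ∀ {k t} → Valid (predℤ k) (prevOffset k t) → Valid k t → Valid (sucℤ k) (nextOffset k t) →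
           Diamond k t → Valid k (suc t)

  W-pos-valid : ∀ {k t} → Valid k t → 1 ≤ W k t
  W-pos-valid {k} base = V-pos k
  W-pos-valid (step _ _ _ diamond) = positive diamond
    where
    positive : ∀ {x y z} → x * y ≡ suc z → 1 ≤ x
    positive {suc x} _ = s≤s z≤n

  -- A step of kind δ leads from offset t on antidiagonal k to offset t′ on antidiagonal k + 1.
  OffsetStep : ℤ → ℕ → Bool → ℕ → Set
  OffsetStep k t δ t′ = Δi δ + t′ ≡ Δi (σ k) + t

  j-step-onto-zero : ∀ {k t} → OffsetStep k t false 0 → σ k ≡ false × t ≡ 0
  j-step-onto-zero {k} {t} = helper (σ k) t
    where
    helper : ∀ b t → 0 ≡ Δi b + t → b ≡ false × t ≡ 0
    helper false zero _ = refl , refl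

  i-step-from-zero : ∀ {k t} → OffsetStep k 0 true t → σ k ≡ true × t ≡ 0
  i-step-from-zero {k} {t} = helper (σ k) t
    where
    helper : ∀ b t → suc t ≡ Δi b + 0 → b ≡ true × t ≡ 0
    helper true zero _ = refl , refl

  prevOffset-from-step : ∀ {j t t′} → OffsetStep j t′ false (suc t) → (if σ j then t else suc t) ≡ t′
  prevOffset-from-step {j} = helper (σ j)
    where
    helper : ∀ b {t t′} → suc t ≡ Δi b + t′ → (if b then t else suc t) ≡ t′
    helper true  e = ℕ.suc-injective e
    helper false e = e

  nextOffset-from-step : ∀ {j t t′} → OffsetStep j (suc t) true t′ → nextOffset j t ≡ t′
  nextOffset-from-step {j} = helper (σ j)
    where
    helper : ∀ b {t t′} → suc t′ ≡ Δi b + suc t → (if b then suc t else t) ≡ t′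
    helper true  e = sym (ℕ.suc-injective e)
    helper false e = sym (ℕ.suc-injective e)

  diamond-above : ∀ {k t t′} → OffsetStep k t′ false (suc t) → Diamond (sucℤ k) t →
                  W (sucℤ k) (suc t) * W (sucℤ k) t ≡
                  1 + W k t′ * W (sucℤ (sucℤ k)) (nextOffset (sucℤ k) t)
  diamond-above {k} {t} {t′} s = subst (λ w → _ ≡ 1 + w * r) W-shared
    where
    r = W (sucℤ (sucℤ k)) (nextOffset (sucℤ k) t)
    W-shared : W (predℤ (sucℤ k)) (prevOffset (sucℤ k) t) ≡ W k t′
    W-shared = trans (cong (λ j → W j (if σ j then t else suc t)) (ℤ.pred-suc k))
                     (cong (W k) (prevOffset-from-step s))

  diamond-below : ∀ {k t t′} → OffsetStep (predℤ k) (suc t) true t′ → Diamond (predℤ k) t →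
                  W (predℤ k) (suc t) * W (predℤ k) t ≡
                  1 + W k t′ * W (predℤ (predℤ k)) (prevOffset (predℤ k) t)
  diamond-below {k} {t} {t′} s d = trans d (cong suc (trans (cong (l *_) W-shared) (ℕ.*-comm l (W k t′))))
    where
    l = W (predℤ (predℤ k)) (prevOffset (predℤ k) t)
    W-shared : W (sucℤ (predℤ k)) (nextOffset (predℤ k) t) ≡ W k t′
    W-shared = cong₂ W (ℤ.suc-pred k) (nextOffset-from-step s)

  j-step-from-below : ∀ {k t t′} → OffsetStep k (suc t) true t′ → OffsetStep k t false t′
  j-step-from-below {k} {t} s = ℕ.suc-injective (trans s (ℕ.+-suc (Δi (σ k)) t))

  divRule-base : ∀ {k δ₁ δ₂} → σ (predℤ k) ≡ δ₁ → σ k ≡ δ₂ →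
                 DivRule δ₁ δ₂ (W (predℤ k) 0) (W k 0) (W (sucℤ k) 0)
  divRule-base {k} refl refl = V-divRule k

  -- divRule-ab: on a lattice path through offsets t₁, t₂, t₃ of the antidiagonals k − 1, k, k + 1
  -- with steps of kinds a and b (i for true, j for false), W obeys DivRule.  Every case moves a vertex
  -- of the path towards the original path across a unit square and uses the diamond relation there.
  module _ {k : ℤ} where

    divRule-ji : ∀ {t₁ t₂ t₃} → OffsetStep (predℤ k) t₁ false t₂ → OffsetStep k t₂ true t₃ →
                 Valid k t₂ → DivRule false true (W (predℤ k) t₁) (W k t₂) (W (sucℤ k) t₃)
    divRule-ji {t₂ = zero} s₁ s₂ _ with j-step-onto-zero s₁ | i-step-from-zero s₂
    ... | σ≡false , refl | σ≡true , refl = divRule-base σ≡false σ≡true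
    divRule-ji {t₁} {suc t₂} {t₃} s₁ s₂ (step _ _ _ diamond) =
      divides (W k t₂) (begin
        x * z + 1                ≡⟨ ℕ.+-comm (x * z) 1 ⟩
        1 + x * z                ≡⟨ diamond′ ⟨
        W k (suc t₂) * W k t₂    ≡⟨ ℕ.*-comm (W k (suc t₂)) (W k t₂) ⟩
        W k t₂ * W k (suc t₂)    ∎)
      where
      open ≡-Reasoning
      x = W (predℤ k) t₁
      z = W (sucℤ k) t₃
      diamond′ : W k (suc t₂) * W k t₂ ≡ 1 + x * z
      diamond′ = subst₂ (λ p n → W k (suc t₂) * W k t₂ ≡ 1 + W (predℤ k) p * W (sucℤ k) n)
                        (prevOffset-from-step s₁) (nextOffset-from-step s₂) diamond

    divRule-jj : ∀ {t₁ t₂ t₃} → OffsetStep (predℤ k) t₁ false t₂ → OffsetStep k t₂ false t₃ →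
                 Valid k t₂ → Valid (sucℤ k) t₃ →
                 DivRule false false (W (predℤ k) t₁) (W k t₂) (W (sucℤ k) t₃)
    divRule-jj {t₃ = zero} s₁ s₂ _ _ with j-step-onto-zero s₂
    ... | σk≡false , refl with j-step-onto-zero s₁
    ...   | σ[k-1]≡false , refl = divRule-base σ[k-1]≡false σk≡false
    -- A j-step to offset t₃ + 1 and an i-step to offset t₃ have the same OffsetStep type.
    divRule-jj {t₁} {t₂} {suc t₃} s₁ s₂ v₂ (step _ _ _ diamond) =
      ∣*+1⇒∣+inverse {x = W (predℤ k) t₁} (diamond-above s₂ diamond) (divRule-ji s₁ s₂ v₂)

    divRule-ii : ∀ {t₁ t₂ t₃} → OffsetStep (predℤ k) t₁ true t₂ → OffsetStep k t₂ true t₃ →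
                 Valid (predℤ k) t₁ → Valid k t₂ →
                 DivRule true true (W (predℤ k) t₁) (W k t₂) (W (sucℤ k) t₃)
    divRule-ii {t₁ = zero} s₁ s₂ _ _ with i-step-from-zero s₁
    ... | σ[k-1]≡true , refl with i-step-from-zero s₂
    ...   | σk≡true , refl = divRule-base σ[k-1]≡true σk≡true
    divRule-ii {suc t₁} {t₂} {t₃} s₁ s₂ (step _ _ _ diamond) v₂ =
      subst (y ∣_) (ℕ.+-comm z x)
        (∣*+1⇒∣+inverse {x = z} {z = x} (diamond-below s₁ diamond)
                                         (subst (λ w → y ∣ w + 1) (ℕ.*-comm c z) IH))
      where
      x = W (predℤ k) (suc t₁)
      c = W (predℤ k) t₁
      y = W k t₂
      z = W (sucℤ k) t₃
      IH : y ∣ c * z + 1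
      IH = divRule-ji (j-step-from-below s₁) s₂ v₂

    divRule-ij : ∀ {t₁ t₂ t₃} → OffsetStep (predℤ k) t₁ true t₂ → OffsetStep k t₂ false t₃ →
                 Valid (predℤ k) t₁ → Valid k t₂ → Valid (sucℤ k) t₃ →
                 DivRule true false (W (predℤ k) t₁) (W k t₂) (W (sucℤ k) t₃)
    divRule-ij {suc t₁} {t₂} {t₃} s₁ s₂ (step _ _ _ diamond) v₂ v₃ =
      subst (λ w → y ∣ w + 1) (ℕ.*-comm z x)
        (∣+⇒∣*inverse+1 {x = z} {z = x} (diamond-below s₁ diamond) (subst (y ∣_) (ℕ.+-comm c z) IH))
      where
      x = W (predℤ k) (suc t₁)
      c = W (predℤ k) t₁
      y = W k t₂
      z = W (sucℤ k) t₃
      IH : y ∣ c + z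
      IH = divRule-jj (j-step-from-below s₁) s₂ v₂ v₃
    divRule-ij {zero} {t₂} {suc t₃} s₁ s₂ v₁ v₂ (step _ _ _ diamond) =
      ∣+⇒∣*inverse+1 {x = W (predℤ k) 0} (diamond-above s₂ diamond) (divRule-ii s₁ s₂ v₁ v₂)
    divRule-ij {zero} {t₂} {zero} s₁ s₂ _ _ _ with i-step-from-zero s₁
    ... | σ[k-1]≡true , refl with j-step-onto-zero s₂
    ...   | σk≡false , _ = divRule-base σ[k-1]≡true σk≡false

  -- The vertices below W k (suc t) form a path with an i-step and then a j-step, and divRule-ij for it
  -- is exactly the divisibility that makes the division defining W k (suc t) exact.
  diamond : ∀ {k t} → Valid (predℤ k) (prevOffset k t) → Valid k t → Valid (sucℤ k) (nextOffset k t) →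
            Diamond k t
  diamond {k} {t} v₁ v₂ v₃ = begin
    W k (suc t) * W k t          ≡⟨ cong (_* W k t) (W-step k t) ⟩
    (1 + xz) /₀ W k t * W k t    ≡⟨ exact (W-pos-valid v₂) divides-xz+1 ⟩
    1 + xz                       ∎
    where
    open ≡-Reasoning
    xz = W (predℤ k) (prevOffset k t) * W (sucℤ k) (nextOffset k t)
    exact : ∀ {x y} → 1 ≤ y → y ∣ x + 1 → (1 + x) /₀ y * y ≡ 1 + x
    exact {x} {suc y} _ y∣x+1 = m/n*n≡m (subst (suc y ∣_) (ℕ.+-comm x 1) y∣x+1)
    i-step-in : ∀ k → OffsetStep (predℤ k) (prevOffset k t) true t
    i-step-in k with σ (predℤ k)
    ... | true  = refl
    ... | false = refl
    j-step-out : ∀ k → OffsetStep k t false (nextOffset k t)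
    j-step-out k with σ k
    ... | true  = refl
    ... | false = refl
    divides-xz+1 : W k t ∣ xz + 1
    divides-xz+1 = divRule-ij (i-step-in k) (j-step-out k) v₁ v₂ v₃

  valid : ∀ {k t} → Dom k t → Valid k t
  valid base         = base
  valid (step p c n) = step (valid p) (valid c) (valid n) (diamond (valid p) (valid c) (valid n))

  W-diamond : ∀ k t → Diamond k t
  W-diamond k t = diamond (valid (dom _ _)) (valid (dom _ _)) (valid (dom _ _))

  W-diamondℤ : ∀ k t → + W k (suc t) ℤ.* + W k t ≡
                       1ℤ ℤ.+ + W (predℤ k) (prevOffset k t) ℤ.* + W (sucℤ k) (nextOffset k t)
  W-diamondℤ k t = begin
    + W k (suc t) ℤ.* + W k t   ≡⟨ ℤ.pos-* (W k (suc t)) (W k t) ⟨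
    + (W k (suc t) * W k t)     ≡⟨ cong +_ (W-diamond k t) ⟩
    + (1 + w₁ * w₂)             ≡⟨ cong (ℤ._+_ 1ℤ) (ℤ.pos-* w₁ w₂) ⟩
    1ℤ ℤ.+ + w₁ ℤ.* + w₂        ∎
    where
    open ≡-Reasoning
    w₁ = W (predℤ k) (prevOffset k t)
    w₂ = W (sucℤ k) (nextOffset k t)

  W-pos : ∀ k t → 1 ≤ W k t
  W-pos k t = W-pos-valid (valid (dom t k))

  module _ (X : ℤ → ℕ → ℤ) (X-zero : ∀ k → X k 0 ≡ + V k)
           (X-diamond : ∀ k t → X k (suc t) ℤ.* X k t ≡
                                1ℤ ℤ.+ X (predℤ k) (prevOffset k t) ℤ.* X (sucℤ k) (nextOffset k t))
           where

    W-unique-dom : ∀ {k t} → Dom k t → X k t ≡ + W k t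
    W-unique-dom {k} base = X-zero k
    W-unique-dom {k} {suc t} (step p c n) = cancel (W-pos k t) (begin
      X k (suc t) ℤ.* + W k t                      ≡⟨ cong (X k (suc t) ℤ.*_) (W-unique-dom c) ⟨
      X k (suc t) ℤ.* X k t                        ≡⟨ X-diamond k t ⟩
      1ℤ ℤ.+ X (predℤ k) p′ ℤ.* X (sucℤ k) n′      ≡⟨ cong₂ (λ a b → 1ℤ ℤ.+ a ℤ.* b) (W-unique-dom p)
                                                                                    (W-unique-dom n) ⟩
      1ℤ ℤ.+ + W (predℤ k) p′ ℤ.* + W (sucℤ k) n′  ≡⟨ W-diamondℤ k t ⟨
      + W k (suc t) ℤ.* + W k t                    ∎)
      where
      open ≡-Reasoning
      p′ = prevOffset k t
      n′ = nextOffset k t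
      cancel : ∀ {x y w} → 1 ≤ w → x ℤ.* + w ≡ y ℤ.* + w → x ≡ y
      cancel {x} {y} {suc w} _ = ℤ.*-cancelʳ-≡ x y (+ suc w)

    W-unique : ∀ k t → X k t ≡ + W k t
    W-unique k t = W-unique-dom (dom t k)

-- Periodic functions on ℤ

module Periodic (N : ℕ) .{{_ : ℕ.NonZero N}} where
  open import Data.Integer using (_+_; _-_; _*_; -_)

  divmod : ∀ d → Σ ℕ λ r → Σ ℤ λ q → r < N × d ≡ + r + q * + N
  divmod d = d %ℕ N , d /ℕ N , n%ℕd<d d N , a≡a%ℕn+[a/ℕn]*n d N

  module _ {ℓ} (P : ℤ → Set ℓ) (P-periodic : ∀ k → P (k ℤ.+ + N) ≡ P k) where

    shift : ∀ q k → P k → P (k + q * + N)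
    shift (+ zero)     k Pk = subst P (sym (lemma k (+ N))) Pk
      where lemma : ∀ k n → k + 0ℤ * n ≡ k
            lemma = solve-∀
    shift (+ suc q)    k Pk = subst P (lemma k (+ q) (+ N)) (subst id (sym (P-periodic _)) (shift (+ q) k Pk))
      where lemma : ∀ k q n → (k + q * n) + n ≡ k + (1ℤ + q) * n
            lemma = solve-∀
    shift -[1+ zero ]  k Pk = subst id (P-periodic _) (subst P (lemma k (+ N)) Pk)
      where lemma : ∀ k n → k ≡ (k + (- 1ℤ) * n) + n
            lemma = solve-∀
    shift -[1+ suc q ] k Pk = subst id (P-periodic _) (subst P (lemma k (+ q) (+ N)) (shift -[1+ q ] k Pk))
      where lemma : ∀ k q n → k + (- (1ℤ + q)) * n ≡ (k + (- (1ℤ + (1ℤ + q))) * n) + n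
            lemma = solve-∀

    periodic-induction : ∀ a → (∀ j → j < N → P (a + + j)) → ∀ k → P k
    periodic-induction a base k with divmod (k - a)
    ... | r , q , r<N , k-a≡r+qN = subst P (sym k≡) (shift q (a + + r) (base r r<N))
      where
      k≡ : k ≡ (a + + r) + q * + N
      k≡ = trans (lemma₁ k a) (trans (cong (_+_ a) k-a≡r+qN) (lemma₂ a (+ r) (q * + N)))
        where lemma₁ : ∀ k a → k ≡ a + (k - a)
              lemma₁ = solve-∀
              lemma₂ : ∀ a r x → a + (r + x) ≡ (a + r) + x
              lemma₂ = solve-∀

  module _ {A : Set} (f : ℤ → A) (f-periodic : ∀ k → f (k ℤ.+ + N) ≡ f k) where

    periodic-shift : ∀ q k → f (k + q * + N) ≡ f k
    periodic-shift q k =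
      shift (λ x → f x ≡ f k) (λ x → cong (_≡ f k) (f-periodic x)) q k refl

    attained-left : ∀ a k → ∃[ r ] f (k - + r) ≡ f a
    attained-left a k with divmod (k - a)
    ... | r , q , _ , k-a≡r+qN = r , trans (cong f k-r≡) (periodic-shift q a)
      where
      k-r≡ : k - + r ≡ a + q * + N
      k-r≡ = trans (lemma₁ k a (+ r))
                   (trans (cong (λ d → a + d - + r) k-a≡r+qN) (lemma₂ a (+ r) (q * + N)))
        where lemma₁ : ∀ k a r → k - r ≡ a + (k - a) - r
              lemma₁ = solve-∀
              lemma₂ : ∀ a r x → a + (r + x) - r ≡ a + x
              lemma₂ = solve-∀

    attained-right : ∀ a k → ∃[ r ] f (k + + r) ≡ f a
    attained-right a k with divmod (a - k)
    ... | r , q , _ , a-k≡r+qN = r , trans (cong f k+r≡) (periodic-shift (- q) a)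
      where
      k+r≡ : k + + r ≡ a + (- q) * + N
      k+r≡ = trans (lemma₁ k a (+ r))
                   (trans (cong (λ d → a - d + + r) a-k≡r+qN) (lemma₂ a (+ r) q (+ N)))
        where lemma₁ : ∀ k a r → k + r ≡ a - (a - k) + r
              lemma₁ = solve-∀
              lemma₂ : ∀ a r q n → a - (r + q * n) + r ≡ a + (- q) * n
              lemma₂ = solve-∀

-- Tilings determined by their values on a path

x-y≡1⇒x≡1+y : ∀ {x y} → x ℤ.- y ≡ 1ℤ → x ≡ 1ℤ ℤ.+ y
x-y≡1⇒x≡1+y {x} {y} x-y≡1 = trans (lemma x y) (cong (ℤ._+ y) x-y≡1)
  where lemma : ∀ x y → x ≡ (x ℤ.- y) ℤ.+ y
        lemma = solve-∀

x≡1+y⇒x-y≡1 : ∀ {x y} → x ≡ 1ℤ ℤ.+ y → x ℤ.- y ≡ 1ℤ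
x≡1+y⇒x-y≡1 {x} {y} x≡1+y = trans (cong (ℤ._- y) x≡1+y) (lemma y)
  where lemma : ∀ y → 1ℤ ℤ.+ y ℤ.- y ≡ 1ℤ
        lemma = solve-∀

UnimodularAt : (ℤ → ℤ → ℤ) → Point → Set
UnimodularAt u (i , j) =
  u (i ℤ.+ + 1) j ℤ.* u i (j ℤ.+ + 1) ℤ.- u i j ℤ.* u (i ℤ.+ + 1) (j ℤ.+ + 1) ≡ + 1

sl2-translate : ∀ {u} → IsSL2Tiling u → ∀ p q → IsSL2Tiling (λ a b → u (a ℤ.+ p) (b ℤ.+ q))
sl2-translate {u} sl2 p q a b =
  trans (cong₂ ℤ._-_ (cong₂ ℤ._*_ (cong (λ x → u x (b ℤ.+ q)) (lemma a p))
                                  (cong (u (a ℤ.+ p)) (lemma b q)))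
                     (cong (u (a ℤ.+ p) (b ℤ.+ q) ℤ.*_) (cong₂ u (lemma a p) (lemma b q))))
        (sl2 (a ℤ.+ p) (b ℤ.+ q))
  where lemma : ∀ x p → x ℤ.+ + 1 ℤ.+ p ≡ x ℤ.+ p ℤ.+ + 1
        lemma = solve-∀

-- h k is the i-coordinate of the path on the antidiagonal i + j = c + k, σ k the kind of its step
-- from antidiagonal k to k + 1, and point k T the point at offset T from it along the antidiagonal.
module PathTiling
  (σ : ℤ → Bool) (V : ℤ → ℕ) (h : ℤ → ℤ) (c : ℤ)
  (h-step : ∀ k → h (sucℤ k) ≡ h k ℤ.+ + Δi (σ k))
  (V-pos : ∀ k → 1 ≤ V k)
  (V-divRule : ∀ k → DivRule (σ (predℤ k)) (σ k) (V (predℤ k)) (V k) (V (sucℤ k)))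
  (σ-leftwards : ∀ b k → ∃[ r ] σ (k ℤ.- + r) ≡ b)
  (σ-rightwards : ∀ b k → ∃[ r ] σ (k ℤ.+ + r) ≡ b)
  where
  open import Data.Integer using (_+_; _-_; _*_; -_)

  pathPoint : ℤ → Point
  pathPoint k = h k , k + c - h k

  point : ℤ → ℤ → Point
  point k T = h k - T , k + c - h k + T

  diagonal : Point → ℤ
  diagonal (a , b) = a + b - c

  offset : Point → ℤ
  offset p = h (diagonal p) - proj₁ p

  point-zero : ∀ k → point k 0ℤ ≡ pathPoint k
  point-zero k = cong₂ _,_ (ℤ.+-identityʳ (h k)) (ℤ.+-identityʳ (k + c - h k))

  diagonal-point : ∀ k T → diagonal (point k T) ≡ k
  diagonal-point k T = lemma (h k) k c T
    where lemma : ∀ x k c T → x - T + (k + c - x + T) - c ≡ k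
          lemma = solve-∀

  offset-point : ∀ k T → offset (point k T) ≡ T
  offset-point k T = trans (cong (λ j → h j - (h k - T)) (diagonal-point k T)) (lemma (h k) T)
    where lemma : ∀ x T → x - (x - T) ≡ T
          lemma = solve-∀

  point-diagonal-offset : ∀ p → point (diagonal p) (offset p) ≡ p
  point-diagonal-offset (a , b) = cong₂ _,_ (lemma₁ (h (a + b - c)) a) (lemma₂ (h (a + b - c)) a b c)
    where lemma₁ : ∀ x a → x - (x - a) ≡ a
          lemma₁ = solve-∀
          lemma₂ : ∀ x a b c → a + b - c + c - x + (x - a) ≡ b
          lemma₂ = solve-∀

  +1-1 : ∀ x → x + 1ℤ - 1ℤ ≡ x
  +1-1 = solve-∀

  module Square (k T : ℤ) where
    a b : ℤ
    a = h k - T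
    b = k + c - h k + T - 1ℤ

    here : point k T ≡ (a , b + 1ℤ)
    here = cong (h k - T ,_) (lemma (k + c - h k + T))
      where lemma : ∀ y → y ≡ y - 1ℤ + 1ℤ
            lemma = solve-∀

    left : point k (T - 1ℤ) ≡ (a + 1ℤ , b)
    left = cong₂ _,_ (lemma₁ (h k) T) (lemma₂ k c (h k) T)
      where lemma₁ : ∀ x T → x - (T - 1ℤ) ≡ x - T + 1ℤ
            lemma₁ = solve-∀
            lemma₂ : ∀ k c x T → k + c - x + (T - 1ℤ) ≡ k + c - x + T - 1ℤ
            lemma₂ = solve-∀

    prev : point (predℤ k) (T - + Δi (σ (predℤ k))) ≡ (a , b)
    prev = cong₂ _,_ (trans (cong (λ x → x - (T - δ)) h[k-1]) (lemma₁ (h k) δ T))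
                     (trans (cong (λ x → predℤ k + c - x + (T - δ)) h[k-1]) (lemma₂ k c (h k) δ T))
      where
      δ = + Δi (σ (predℤ k))
      h[k-1] : h (predℤ k) ≡ h k - δ
      h[k-1] = trans (lemma (h (predℤ k)) δ)
                     (cong (_- δ) (sym (trans (cong h (sym (ℤ.suc-pred k))) (h-step (predℤ k)))))
        where lemma : ∀ x d → x ≡ x + d - d
              lemma = solve-∀
      lemma₁ : ∀ x d T → x - d - (T - d) ≡ x - T
      lemma₁ = solve-∀
      lemma₂ : ∀ k c x d T → -1ℤ + k + c - (x - d) + (T - d) ≡ k + c - x + T - 1ℤ
      lemma₂ = solve-∀

    next : point (sucℤ k) (T + + Δi (σ k) - 1ℤ) ≡ (a + 1ℤ , b + 1ℤ)
    next = cong₂ _,_ (trans (cong (λ x → x - (T + δ - 1ℤ)) (h-step k)) (lemma₁ (h k) δ T))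
                     (trans (cong (λ x → sucℤ k + c - x + (T + δ - 1ℤ)) (h-step k)) (lemma₂ k c (h k) δ T))
      where
      δ = + Δi (σ k)
      lemma₁ : ∀ x d T → x + d - (T + d - 1ℤ) ≡ x - T + 1ℤ
      lemma₁ = solve-∀
      lemma₂ : ∀ k c x d T → 1ℤ + k + c - (x + d) + (T + d - 1ℤ) ≡ k + c - x + T - 1ℤ + 1ℤ
      lemma₂ = solve-∀

  DiamondAt : (ℤ → ℤ → ℤ) → ℤ → ℤ → Set
  DiamondAt F k T =
    F k (T - 1ℤ) * F k T ≡
    1ℤ + F (predℤ k) (T - + Δi (σ (predℤ k))) * F (sucℤ k) (T + + Δi (σ k) - 1ℤ)

  DiamondRule : (ℤ → ℤ → ℤ) → Set
  DiamondRule F = ∀ k T → DiamondAt F k T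

  sl2⇒diamondRule : ∀ {u} → IsSL2Tiling u → DiamondRule (λ k T → uncurry u (point k T))
  sl2⇒diamondRule {u} sl2 k T = x-y≡1⇒x≡1+y (trans (cong₂ _-_ (cong₂ _*_ (at left) (at here))
                                                                (cong₂ _*_ (at prev) (at next)))
                                                     (sl2 a b))
    where
    open Square k T
    at : ∀ {p q} → p ≡ q → uncurry u p ≡ uncurry u q
    at = cong (uncurry u)

  diamondRule⇒sl2 : ∀ {F} → DiamondRule F → IsSL2Tiling (λ a b → F (diagonal (a , b)) (offset (a , b)))
  diamondRule⇒sl2 {F} rule a b = subst (UnimodularAt U) corner≡ab (unimodular k T)
    where
    U : ℤ → ℤ → ℤ
    U a b = F (diagonal (a , b)) (offset (a , b))
    at : ∀ {p k T} → p ≡ point k T → uncurry U p ≡ F k T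
    at {p} {k} {T} refl = cong₂ F (diagonal-point k T) (offset-point k T)
    unimodular : ∀ k T → UnimodularAt U (Square.a k T , Square.b k T)
    unimodular k T = trans (cong₂ _-_ (cong₂ _*_ (at (sym left)) (at (sym here)))
                                      (cong₂ _*_ (at (sym prev)) (at (sym next))))
                           (x≡1+y⇒x-y≡1 (rule k T))
      where open Square k T
    k = diagonal (a , b + 1ℤ)
    T = offset (a , b + 1ℤ)
    corner≡ab : (Square.a k T , Square.b k T) ≡ (a , b)
    corner≡ab = cong₂ _,_ (cong proj₁ (point-diagonal-offset (a , b + 1ℤ)))
                          (trans (cong (λ y → proj₂ y - 1ℤ) (point-diagonal-offset (a , b + 1ℤ))) (+1-1 b))

  -- At negative offsets the roles of the two kinds of steps are exchanged.
  σ⁻ : ℤ → Bool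
  σ⁻ k = not (σ k)

  σ⁻-leftwards : ∀ k → ∃[ r ] σ⁻ (k - + r) ≡ true
  σ⁻-leftwards k with σ-leftwards false k
  ... | r , σ≡false = r , cong not σ≡false

  σ⁻-rightwards : ∀ k → ∃[ r ] σ⁻ (k + + r) ≡ false
  σ⁻-rightwards k with σ-rightwards true k
  ... | r , σ≡true = r , cong not σ≡true

  V-divRule⁻ : ∀ k → DivRule (σ⁻ (predℤ k)) (σ⁻ k) (V (predℤ k)) (V k) (V (sucℤ k))
  V-divRule⁻ k = DivRule-not (V-divRule k)

  module W⁺ = HalfTiling σ V V-pos V-divRule (σ-leftwards true) (σ-rightwards false)
  module W⁻ = HalfTiling σ⁻ V V-pos V-divRule⁻ σ⁻-leftwards σ⁻-rightwards

  G : ℤ → ℤ → ℕ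
  G k (+ t)    = W⁺.W k t
  G k -[1+ t ] = W⁻.W k (suc t)

  Gℤ : ℤ → ℤ → ℤ
  Gℤ k T = + G k T

  G-neg : ∀ k t → G k (- + t) ≡ W⁻.W k t
  G-neg k zero    = refl
  G-neg k (suc t) = refl

  G-pos : ∀ k T → 1 ≤ G k T
  G-pos k (+ t)    = W⁺.W-pos k t
  G-pos k -[1+ t ] = W⁻.W-pos k (suc t)

  suc-1 : ∀ t → + suc t - 1ℤ ≡ + t
  suc-1 t = lemma (+ t)
    where lemma : ∀ t → 1ℤ + t - 1ℤ ≡ t
          lemma = solve-∀

  neg-1 : ∀ t → - + t - 1ℤ ≡ - + suc t
  neg-1 t = lemma (+ t)
    where lemma : ∀ t → - t - 1ℤ ≡ - (1ℤ + t)
          lemma = solve-∀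

  prevOffset⁺ : ∀ b t → + suc t - + Δi b ≡ + (if b then t else suc t)
  prevOffset⁺ true  t = suc-1 t
  prevOffset⁺ false t = ℤ.+-identityʳ (+ suc t)

  nextOffset⁺ : ∀ b t → + suc t + + Δi b - 1ℤ ≡ + (if b then suc t else t)
  nextOffset⁺ true  t = +1-1 (+ suc t)
  nextOffset⁺ false t = trans (cong (_- 1ℤ) (ℤ.+-identityʳ (+ suc t))) (suc-1 t)

  prevOffset⁻ : ∀ b t → - + t - + Δi b ≡ - + (if not b then t else suc t)
  prevOffset⁻ true  t = neg-1 t
  prevOffset⁻ false t = ℤ.+-identityʳ (- + t)

  nextOffset⁻ : ∀ b t → - + t + + Δi b - 1ℤ ≡ - + (if not b then suc t else t)
  nextOffset⁻ true  t = +1-1 (- + t)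
  nextOffset⁻ false t = trans (cong (_- 1ℤ) (ℤ.+-identityʳ (- + t))) (neg-1 t)

  module _ (F : ℤ → ℤ → ℤ) where

    DiamondAt⇒ : ∀ {k T T₀ T₁ T₂} →
                 T - 1ℤ ≡ T₀ → T - + Δi (σ (predℤ k)) ≡ T₁ → T + + Δi (σ k) - 1ℤ ≡ T₂ →
                 DiamondAt F k T → F k T₀ * F k T ≡ 1ℤ + F (predℤ k) T₁ * F (sucℤ k) T₂
    DiamondAt⇒ refl refl refl d = d

    ⇒DiamondAt : ∀ {k T T₀ T₁ T₂} →
                 T - 1ℤ ≡ T₀ → T - + Δi (σ (predℤ k)) ≡ T₁ → T + + Δi (σ k) - 1ℤ ≡ T₂ →
                 F k T₀ * F k T ≡ 1ℤ + F (predℤ k) T₁ * F (sucℤ k) T₂ → DiamondAt F k T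
    ⇒DiamondAt refl refl refl d = d

    Diamond⁺ Diamond⁻ : Set
    Diamond⁺ = ∀ k t → F k (+ suc t) * F k (+ t) ≡
                       1ℤ + F (predℤ k) (+ W⁺.prevOffset k t) * F (sucℤ k) (+ W⁺.nextOffset k t)
    Diamond⁻ = ∀ k t → F k (- + suc t) * F k (- + t) ≡
                       1ℤ + F (predℤ k) (- + W⁻.prevOffset k t) * F (sucℤ k) (- + W⁻.nextOffset k t)

    diamond⁺ : DiamondRule F → Diamond⁺
    diamond⁺ rule k t = trans (ℤ.*-comm (F k (+ suc t)) (F k (+ t)))
      (DiamondAt⇒ (suc-1 t) (prevOffset⁺ (σ (predℤ k)) t) (nextOffset⁺ (σ k) t) (rule k (+ suc t)))

    diamond⁻ : DiamondRule F → Diamond⁻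
    diamond⁻ rule k t =
      DiamondAt⇒ (neg-1 t) (prevOffset⁻ (σ (predℤ k)) t) (nextOffset⁻ (σ k) t) (rule k (- + t))

    diamondRule : Diamond⁺ → Diamond⁻ → DiamondRule F
    diamondRule d⁺ d⁻ k (+ suc t) =
      ⇒DiamondAt (suc-1 t) (prevOffset⁺ (σ (predℤ k)) t) (nextOffset⁺ (σ k) t)
                 (trans (ℤ.*-comm (F k (+ t)) (F k (+ suc t))) (d⁺ k t))
    diamondRule d⁺ d⁻ k (+ zero) =
      ⇒DiamondAt (neg-1 0) (prevOffset⁻ (σ (predℤ k)) 0) (nextOffset⁻ (σ k) 0) (d⁻ k 0)
    diamondRule d⁺ d⁻ k -[1+ t ] =
      ⇒DiamondAt (neg-1 (suc t)) (prevOffset⁻ (σ (predℤ k)) (suc t)) (nextOffset⁻ (σ k) (suc t))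
                 (d⁻ k (suc t))

  G-diamond⁺ : Diamond⁺ Gℤ
  G-diamond⁺ = W⁺.W-diamondℤ

  G-diamond⁻ : Diamond⁻ Gℤ
  G-diamond⁻ k t =
    trans (cong (λ x → + W⁻.W k (suc t) * + x) (G-neg k t))
          (trans (W⁻.W-diamondℤ k t)
                 (cong₂ (λ x y → 1ℤ + + x * + y) (sym (G-neg (predℤ k) (W⁻.prevOffset k t)))
                                                 (sym (G-neg (sucℤ k) (W⁻.nextOffset k t)))))

  tiling : ℤ → ℤ → ℤ
  tiling a b = Gℤ (diagonal (a , b)) (offset (a , b))

  tiling-sl2 : IsSL2Tiling tiling
  tiling-sl2 = diamondRule⇒sl2 {Gℤ} (diamondRule Gℤ G-diamond⁺ G-diamond⁻)

  tiling-pos : IsPositive tiling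
  tiling-pos a b = ℤ.+<+ (G-pos (diagonal (a , b)) (offset (a , b)))

  tiling-pathPoint : ∀ k → uncurry tiling (pathPoint k) ≡ + V k
  tiling-pathPoint k = subst (λ p → uncurry tiling p ≡ + V k) (point-zero k)
                             (cong₂ Gℤ (diagonal-point k 0ℤ) (offset-point k 0ℤ))

  tiling-unique : ∀ u → IsSL2Tiling u → (∀ k → uncurry u (pathPoint k) ≡ + V k) →
                  ∀ a b → u a b ≡ tiling a b
  tiling-unique u sl2 u-pathPoint a b =
    trans (cong (uncurry u) (sym (point-diagonal-offset (a , b)))) (F≡G (diagonal (a , b)) (offset (a , b)))
    where
    F : ℤ → ℤ → ℤ
    F k T = uncurry u (point k T)
    F-zero : ∀ k → F k 0ℤ ≡ + V k
    F-zero k = trans (cong (uncurry u) (point-zero k)) (u-pathPoint k)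
    rule : DiamondRule F
    rule = sl2⇒diamondRule {u} sl2
    F≡G : ∀ k T → F k T ≡ Gℤ k T
    F≡G k (+ t)    = W⁺.W-unique (λ k t → F k (+ t)) F-zero (diamond⁺ F rule) k t
    F≡G k -[1+ t ] = W⁻.W-unique (λ k t → F k (- + t)) F-zero (diamond⁻ F rule) k (suc t)

-- The periodic lattice path

2∤1 : ¬ 2 ∣ 1
2∤1 2∣1 = contradiction (∣1⇒≡1 2∣1) λ ()

∣ℤ*+1⇒∣*+1 : ∀ {x y z} → (+ y) ∣ℤ (+ z ℤ.* + x ℤ.+ + 1) → y ∣ x ℕ.* z ℕ.+ 1
∣ℤ*+1⇒∣*+1 {x} {y} {z} y∣zx+1 =
  subst (λ w → y ∣ w ℕ.+ 1) (ℕ.*-comm z x)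
        (subst (λ w → (+ y) ∣ℤ (w ℤ.+ + 1)) (sym (ℤ.pos-* z x)) y∣zx+1)

DivRule-of-parity : ∀ a b {x y z d} → d ≡ + Δi a ℤ.+ + Δi b →
                    ((+ 2) ∣ℤ d → (+ y) ∣ℤ (+ z ℤ.+ + x)) →
                    (¬ ((+ 2) ∣ℤ d) → (+ y) ∣ℤ (+ z ℤ.* + x ℤ.+ + 1)) →
                    DivRule a b x y z
DivRule-of-parity true  true  {x} {y} {z} refl even _ = subst (y ∣_) (ℕ.+-comm z x) (even ∣-refl)
DivRule-of-parity false false {x} {y} {z} refl even _ = subst (y ∣_) (ℕ.+-comm z x) (even (2 ∣0))
DivRule-of-parity true  false {x} {y} {z} refl _ odd = ∣ℤ*+1⇒∣*+1 {x} {y} {z} (odd 2∤1)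
DivRule-of-parity false true  {x} {y} {z} refl _ odd = ∣ℤ*+1⇒∣*+1 {x} {y} {z} (odd 2∤1)

module LatticePath (m′ n : ℕ) (n≥1 : 1 ≤ n) (i j : ℤ) (π : ℕ → Point)
                   (path : IsLatticePath (suc m′) n i j π) (v : ℕ → ℕ)
                   (v-pos : ∀ x → x ≤ suc m′ ℕ.+ n → 1 ≤ v x) (v-closed : v 0 ≡ v (suc m′ ℕ.+ n))
                   where
  open import Data.Integer using (_+_; _-_; _*_; -_)

  m N′ N : ℕ
  m  = suc m′
  N′ = m′ ℕ.+ n
  N  = suc N′

  c : ℤ
  c = i + j

  row col : ℕ → ℤ
  row x = proj₁ (π x)
  col x = proj₂ (π x)

  stepKind : ℕ → Bool
  stepKind x = does (row (suc x) ℤ.≟ row x + 1ℤ)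

  π-step : ∀ x → x < N → π (suc x) ≡ (row x + + Δi (stepKind x) , col x + 1ℤ - + Δi (stepKind x))
  π-step x x<N with row (suc x) ℤ.≟ row x + 1ℤ | proj₂ (proj₂ path) x x<N
  ... | yes _  | inj₂ π[x+1]≡ = trans π[x+1]≡ (cong (row x + 1ℤ ,_) (lemma (col x)))
    where lemma : ∀ y → y ≡ y + 1ℤ - 1ℤ
          lemma = solve-∀
  ... | no _   | inj₁ π[x+1]≡ =
    trans π[x+1]≡ (cong₂ _,_ (sym (ℤ.+-identityʳ (row x))) (sym (ℤ.+-identityʳ _)))
  ... | yes r≡ | inj₁ π[x+1]≡ =
    ⊥-elim (ℤ.i≢suc[i] (trans (trans (sym (cong proj₁ π[x+1]≡)) r≡) (ℤ.+-comm (row x) 1ℤ)))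
  ... | no r≢  | inj₂ π[x+1]≡ = ⊥-elim (r≢ (cong proj₁ π[x+1]≡))

  σN : ℕ → Bool
  σN x = stepKind (x % N)

  hN : ℕ → ℤ
  hN zero    = i
  hN (suc x) = hN x + + Δi (σN x)

  π-hN : ∀ x → x ≤ N → π x ≡ (hN x , + x + c - hN x)
  π-hN zero _ = trans (proj₁ path) (cong (i ,_) (lemma i j))
    where lemma : ∀ i j → j ≡ 0ℤ + (i + j) - i
          lemma = solve-∀
  π-hN (suc x) x<N = trans (π-step x x<N)
    (cong₂ _,_ (cong₂ _+_ (cong proj₁ IH) Δ≡)
               (trans (cong₂ (λ y d → y + 1ℤ - d) (cong proj₂ IH) Δ≡)
                      (lemma (+ x) c (hN x) (+ Δi (σN x)))))
    where
    IH = π-hN x (ℕ.<⇒≤ x<N)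
    Δ≡ : + Δi (stepKind x) ≡ + Δi (σN x)
    Δ≡ = cong (λ r → + Δi (stepKind r)) (sym (m<n⇒m%n≡m x<N))
    lemma : ∀ x c h d → x + c - h + 1ℤ - d ≡ 1ℤ + x + c - (h + d)
    lemma = solve-∀

  hN-periodic : ∀ x → hN (x ℕ.+ N) ≡ hN x + + m
  hN-periodic zero    = trans (cong proj₁ (sym (π-hN N ℕ.≤-refl))) (cong proj₁ (proj₁ (proj₂ path)))
  hN-periodic (suc x) = trans (cong₂ _+_ (hN-periodic x) (cong (λ r → + Δi (stepKind r)) ([m+n]%n≡m%n x N)))
                              (lemma (hN x) (+ m) (+ Δi (σN x)))
    where lemma : ∀ h m d → h + m + d ≡ h + d + m
          lemma = solve-∀

  hN-quasiperiodic : ∀ x q → hN (x ℕ.+ q ℕ.* N) ≡ hN x + + (q ℕ.* m)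
  hN-quasiperiodic x zero    = trans (cong hN (ℕ.+-identityʳ x)) (sym (ℤ.+-identityʳ (hN x)))
  hN-quasiperiodic x (suc q) = begin
    hN (x ℕ.+ (N ℕ.+ q ℕ.* N))     ≡⟨ cong hN (lemma x N (q ℕ.* N)) ⟩
    hN (x ℕ.+ q ℕ.* N ℕ.+ N)       ≡⟨ hN-periodic (x ℕ.+ q ℕ.* N) ⟩
    hN (x ℕ.+ q ℕ.* N) + + m       ≡⟨ cong (_+ + m) (hN-quasiperiodic x q) ⟩
    hN x + + (q ℕ.* m) + + m       ≡⟨ lemma′ (hN x) (+ (q ℕ.* m)) (+ m) ⟩
    hN x + (+ m + + (q ℕ.* m))     ∎
    where
    open ≡-Reasoning
    lemma : ∀ x n y → x ℕ.+ (n ℕ.+ y) ≡ x ℕ.+ y ℕ.+ n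
    lemma = ℕ-Solver.solve-∀
    lemma′ : ∀ h a b → h + a + b ≡ h + (b + a)
    lemma′ = solve-∀

  -- k + periods k * N ≡ + lifted k; σ, V and h extend the data of the path to ℤ through lifted.
  periods lifted : ℤ → ℕ
  periods (+ x)    = 0
  periods -[1+ p ] = suc p
  lifted (+ x)    = x
  lifted -[1+ p ] = suc p ℕ.* N′

  lifted-correct : ∀ k → k + + (periods k ℕ.* N) ≡ + lifted k
  lifted-correct (+ x)    = cong +_ (ℕ.+-identityʳ x)
  lifted-correct -[1+ p ] = begin
    -[1+ p ] + + (suc p ℕ.* N)                ≡⟨ cong (λ y → -[1+ p ] + + y) (ℕ.*-suc (suc p) N′) ⟩
    -[1+ p ] + + (suc p ℕ.+ suc p ℕ.* N′)     ≡⟨ cong (_+_ -[1+ p ]) (ℤ.pos-+ (suc p) (suc p ℕ.* N′)) ⟩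
    - + suc p + (+ suc p + + (suc p ℕ.* N′))  ≡⟨ lemma (+ suc p) (+ (suc p ℕ.* N′)) ⟩
    + (suc p ℕ.* N′)                          ∎
    where
    open ≡-Reasoning
    lemma : ∀ a b → - a + (a + b) ≡ b
    lemma = solve-∀

  lifted-unique : ∀ {k q x} → k + + (q ℕ.* N) ≡ + x →
                lifted k ℕ.+ q ℕ.* N ≡ x ℕ.+ periods k ℕ.* N
  lifted-unique {k} {q} {x} k+qN≡x = ℤ.+-injective (begin
    + (x₀ ℕ.+ q ℕ.* N)       ≡⟨ ℤ.pos-+ x₀ (q ℕ.* N) ⟩
    + x₀ + + (q ℕ.* N)       ≡⟨ cong (_+ + (q ℕ.* N)) (lifted-correct k) ⟨
    k + Q₀ + + (q ℕ.* N)     ≡⟨ lemma k Q₀ (+ (q ℕ.* N)) ⟩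
    k + + (q ℕ.* N) + Q₀     ≡⟨ cong (_+ Q₀) k+qN≡x ⟩
    + x + Q₀                 ≡⟨ ℤ.pos-+ x (q₀ ℕ.* N) ⟨
    + (x ℕ.+ q₀ ℕ.* N)       ∎)
    where
    open ≡-Reasoning
    q₀ = periods k
    x₀ = lifted k
    Q₀ = + (q₀ ℕ.* N)
    lemma : ∀ k a b → k + a + b ≡ k + b + a
    lemma = solve-∀

  residue : ℤ → ℕ
  residue k = lifted k % N

  residue-unique : ∀ k q {x} → k + + (q ℕ.* N) ≡ + x → residue k ≡ x % N
  residue-unique k q {x} e = begin
    lifted k % N                        ≡⟨ [m+kn]%n≡m%n (lifted k) q N ⟨
    (lifted k ℕ.+ q ℕ.* N) % N          ≡⟨ cong (_% N) (lifted-unique {k} {q} e) ⟩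
    (x ℕ.+ periods k ℕ.* N) % N          ≡⟨ [m+kn]%n≡m%n x (periods k) N ⟩
    x % N                                     ∎
    where open ≡-Reasoning

  σ : ℤ → Bool
  σ k = stepKind (residue k)

  V : ℤ → ℕ
  V k = v (residue k)

  h : ℤ → ℤ
  h k = hN (lifted k) - + (periods k ℕ.* m)

  h-unique : ∀ k q {x} → k + + (q ℕ.* N) ≡ + x → h k ≡ hN x - + (q ℕ.* m)
  h-unique k q {x} e = lemma (hN x₀) (+ (q ℕ.* m)) (hN x) (+ (q₀ ℕ.* m)) (begin
    hN x₀ + + (q ℕ.* m)           ≡⟨ hN-quasiperiodic x₀ q ⟨
    hN (x₀ ℕ.+ q ℕ.* N)           ≡⟨ cong hN (lifted-unique {k} {q} e) ⟩
    hN (x ℕ.+ q₀ ℕ.* N)           ≡⟨ hN-quasiperiodic x q₀ ⟩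
    hN x + + (q₀ ℕ.* m)           ∎)
    where
    open ≡-Reasoning
    q₀ = periods k
    x₀ = lifted k
    lemma : ∀ a b c d → a + b ≡ c + d → a - d ≡ c - b
    lemma a b c d e = trans (lemma₁ a b d) (trans (cong (λ y → y - b - d) e) (lemma₂ c b d))
      where lemma₁ : ∀ a b d → a - d ≡ a + b - b - d
            lemma₁ = solve-∀
            lemma₂ : ∀ c b d → c + d - b - d ≡ c - b
            lemma₂ = solve-∀

  lifted-suc : ∀ k → sucℤ k + + (periods k ℕ.* N) ≡ + suc (lifted k)
  lifted-suc k = trans (lemma k (+ (periods k ℕ.* N))) (cong (_+_ 1ℤ) (lifted-correct k))
    where lemma : ∀ k a → 1ℤ + k + a ≡ 1ℤ + (k + a)
          lemma = solve-∀

  lifted-+N : ∀ k → k + + N + + (periods k ℕ.* N) ≡ + (lifted k ℕ.+ N)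
  lifted-+N k = trans (lemma k (+ N) (+ (periods k ℕ.* N)))
                    (trans (cong (_+ + N) (lifted-correct k)) (sym (ℤ.pos-+ (lifted k) N)))
    where lemma : ∀ k n a → k + n + a ≡ k + a + n
          lemma = solve-∀

  h-step : ∀ k → h (sucℤ k) ≡ h k + + Δi (σ k)
  h-step k = trans (h-unique (sucℤ k) (periods k) (lifted-suc k))
                   (lemma (hN (lifted k)) (+ Δi (σ k)) (+ (periods k ℕ.* m)))
    where
    lemma : ∀ a d b → a + d - b ≡ a - b + d
    lemma = solve-∀

  residue-periodic : ∀ k → residue (k + + N) ≡ residue k
  residue-periodic k = trans (residue-unique (k + + N) (periods k) (lifted-+N k)) ([m+n]%n≡m%n (lifted k) N)

  σ-periodic : ∀ k → σ (k + + N) ≡ σ k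
  σ-periodic k = cong stepKind (residue-periodic k)

  V-periodic : ∀ k → V (k + + N) ≡ V k
  V-periodic k = cong v (residue-periodic k)

  h-periodic : ∀ k → h (k + + N) ≡ h k + + m
  h-periodic k = trans (h-unique (k + + N) (periods k) (lifted-+N k))
                       (trans (cong (_- + (periods k ℕ.* m)) (hN-periodic (lifted k)))
                              (lemma (hN (lifted k)) (+ m) (+ (periods k ℕ.* m))))
    where lemma : ∀ a d b → a + d - b ≡ a - b + d
          lemma = solve-∀

  π-pathPoint : ∀ x → x ≤ N → π x ≡ (h (+ x) , + x + c - h (+ x))
  π-pathPoint x x≤N = trans (π-hN x x≤N) (cong (λ y → y , + x + c - y) (sym (ℤ.+-identityʳ (hN x))))

  V-pos : ∀ k → 1 ≤ V k
  V-pos k = v-pos (residue k) (ℕ.<⇒≤ (m%n<n (lifted k) N))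

  V-nat : ∀ x → x ≤ N → V (+ x) ≡ v x
  V-nat x x≤N with ℕ.m≤n⇒m<n∨m≡n x≤N
  ... | inj₁ x<N  = cong v (m<n⇒m%n≡m x<N)
  ... | inj₂ refl = trans (cong v (n%n≡0 N)) v-closed

  hN-constant : ∀ b x → x ≤ N → (∀ r → r < x → stepKind r ≡ b) → hN x ≡ i + + Δi b * + x
  hN-constant b zero    _   _     = sym (trans (cong (_+_ i) (ℤ.*-zeroʳ (+ Δi b))) (ℤ.+-identityʳ i))
  hN-constant b (suc x) x<N steps = begin
    hN x + + Δi (σN x)                     ≡⟨ cong₂ _+_ IH (cong (λ r → + Δi (stepKind r)) (m<n⇒m%n≡m x<N)) ⟩
    i + + Δi b * + x + + Δi (stepKind x)   ≡⟨ cong (λ b′ → i + + Δi b * + x + + Δi b′) (steps x ℕ.≤-refl) ⟩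
    i + + Δi b * + x + + Δi b              ≡⟨ lemma i (+ Δi b) (+ x) ⟩
    i + + Δi b * (1ℤ + + x)                ∎
    where
    open ≡-Reasoning
    IH = hN-constant b x (ℕ.<⇒≤ x<N) (λ r r<x → steps r (ℕ.m<n⇒m<1+n r<x))
    lemma : ∀ i d x → i + d * x + d ≡ i + d * (1ℤ + x)
    lemma = solve-∀

  σ-attains : ∀ b → ∃[ x ] σ (+ x) ≡ b
  σ-attains b with ℕ.anyUpTo? (λ r → stepKind r Bool.≟ b) N
  ... | yes (x , x<N , e) = x , trans (cong stepKind (m<n⇒m%n≡m x<N)) e
  ... | no ∄ = ⊥-elim (impossible (not b) (cancel i (trans (sym (hN-constant (not b) N ℕ.≤-refl all-not-b))
                                                          (hN-periodic 0))))
    where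
    all-not-b : ∀ r → r < N → stepKind r ≡ not b
    all-not-b r r<N = Bool.¬-not (λ e → ∄ (r , r<N , e))
    cancel : ∀ a {x y} → a + x ≡ a + y → x ≡ y
    cancel a {x} {y} e = trans (lemma a x) (trans (cong (_- a) e) (sym (lemma a y)))
      where lemma : ∀ a x → x ≡ a + x - a
            lemma = solve-∀
    impossible : ∀ b′ → + Δi b′ * + N ≢ + m
    impossible false ()
    impossible true  N≡m = ℕ.<⇒≢ n≥1 (sym n≡0)
      where
      m′+n≡m′ : m′ ℕ.+ n ≡ m′
      m′+n≡m′ = ℕ.suc-injective (ℤ.+-injective (trans (sym (ℤ.*-identityˡ (+ N))) N≡m))
      n≡0 : n ≡ 0
      n≡0 = ℕ.+-cancelˡ-≡ m′ n 0 (trans m′+n≡m′ (sym (ℕ.+-identityʳ m′)))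

  open Periodic N using (periodic-induction; attained-left; attained-right)

  σ-leftwards : ∀ b k → ∃[ r ] σ (k - + r) ≡ b
  σ-leftwards b k with σ-attains b
  ... | x , σx≡b with attained-left σ σ-periodic (+ x) k
  ...   | r , e = r , trans e σx≡b

  σ-rightwards : ∀ b k → ∃[ r ] σ (k + + r) ≡ b
  σ-rightwards b k with σ-attains b
  ... | x , σx≡b with attained-right σ σ-periodic (+ x) k
  ...   | r , e = r , trans e σx≡b

  extPos-row : ∀ t → proj₁ (extPos m n π t) ≡ hN t
  extPos-row t = begin
    row (t % N) + + (t / N ℕ.* m)      ≡⟨ cong (λ r → proj₁ r + + (t / N ℕ.* m)) (π-hN (t % N) t%N≤N) ⟩
    hN (t % N) + + (t / N ℕ.* m)       ≡⟨ hN-quasiperiodic (t % N) (t / N) ⟨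
    hN (t % N ℕ.+ t / N ℕ.* N)         ≡⟨ cong hN (m≡m%n+[m/n]*n t N) ⟨
    hN t                               ∎
    where
    open ≡-Reasoning
    t%N≤N = ℕ.<⇒≤ (m%n<n t N)

  V-divRule : DivCondition m n π v → ∀ k → DivRule (σ (predℤ k)) (σ k) (V (predℤ k)) (V k) (V (sucℤ k))
  V-divRule dc = periodic-induction P P-periodic 1ℤ base
    where
    P : ℤ → Set
    P k = DivRule (σ (predℤ k)) (σ k) (V (predℤ k)) (V k) (V (sucℤ k))
    pred-+N : ∀ k n → -1ℤ + (k + n) ≡ -1ℤ + k + n
    pred-+N = solve-∀
    suc-+N : ∀ k n → 1ℤ + (k + n) ≡ 1ℤ + k + n
    suc-+N = solve-∀
    P-periodic : ∀ k → P (k + + N) ≡ P k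
    P-periodic k rewrite pred-+N k (+ N) | suc-+N k (+ N) | σ-periodic (predℤ k) | σ-periodic k
                       | V-periodic (predℤ k) | V-periodic k | V-periodic (sucℤ k) = refl
    base : ∀ x → x < N → P (1ℤ + + x)
    base x x<N = DivRule-of-parity (σ (+ x)) (σ (+ suc x)) parity even odd
      where
      cond = dc (suc x) (s≤s z≤n) x<N
      even = proj₁ cond
      odd = proj₂ cond
      parity : proj₁ (extPos m n π (suc (suc x))) - proj₁ (extPos m n π x) ≡
               + Δi (σ (+ x)) + + Δi (σ (+ suc x))
      parity = trans (cong₂ _-_ (extPos-row (suc (suc x))) (extPos-row x))
                     (lemma (hN x) (+ Δi (σ (+ x))) (+ Δi (σ (+ suc x))))
        where lemma : ∀ h a b → h + a + b - h ≡ a + b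
              lemma = solve-∀

  DivCondition-of-ones : (∀ x → x ≤ N → v x ≡ 1) → DivCondition m n π v
  DivCondition-of-ones v≡1 k _ _ = (λ _ → one∣ _) , (λ _ → one∣ _)
    where one∣ : ∀ w → v (k % N) ∣ w
          one∣ w = subst (_∣ w) (sym (v≡1 (k % N) (ℕ.<⇒≤ (m%n<n k N)))) (1∣ w)

  module _ (dc : DivCondition m n π v) where
    open PathTiling σ V h c h-step V-pos (V-divRule dc) σ-leftwards σ-rightwards

    pathPoint-periodic : ∀ k → pathPoint (k + + N) ≡ (h k + + m , k + c - h k + + n)
    pathPoint-periodic k = cong₂ _,_ (h-periodic k) (trans (cong (λ y → k + + N + c - y) (h-periodic k))
                                                         (lemma k c (h k) (+ m) (+ n)))
      where lemma : ∀ k c h m n → k + (m + n) + c - (h + m) ≡ k + c - h + n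
            lemma = solve-∀

    tiling-periodic : IsPeriodic m n tiling
    tiling-periodic a b =
      tiling-unique shifted (sl2-translate {tiling} tiling-sl2 (+ m) (+ n)) shifted-on-path a b
      where
      shifted : ℤ → ℤ → ℤ
      shifted a b = tiling (a + + m) (b + + n)
      shifted-on-path : ∀ k → uncurry shifted (pathPoint k) ≡ + V k
      shifted-on-path k = trans (cong (uncurry tiling) (sym (pathPoint-periodic k)))
                                (trans (tiling-pathPoint (k + + N)) (cong +_ (V-periodic k)))

    tiling-on-π : ∀ x → x ≤ N → uncurry tiling (π x) ≡ + v x
    tiling-on-π x x≤N = trans (cong (uncurry tiling) (π-pathPoint x x≤N))
                              (trans (tiling-pathPoint (+ x)) (cong +_ (V-nat x x≤N)))

    solution-on-pathPoint : ∀ u → IsSolution m n π v u → ∀ k → uncurry u (pathPoint k) ≡ + V k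
    solution-on-pathPoint u (_ , _ , u-periodic , u-on-π) = periodic-induction P P-periodic 0ℤ base
      where
      P : ℤ → Set
      P k = uncurry u (pathPoint k) ≡ + V k
      P-periodic : ∀ k → P (k + + N) ≡ P k
      P-periodic k = cong₂ _≡_ (trans (cong (uncurry u) (pathPoint-periodic k))
                                      (u-periodic (h k) (k + c - h k)))
                               (cong +_ (V-periodic k))
      base : ∀ x → x < N → P (0ℤ + + x)
      base x x<N = trans (cong (uncurry u) (sym (π-pathPoint x (ℕ.<⇒≤ x<N))))
                         (trans (u-on-π x (ℕ.<⇒≤ x<N)) (cong +_ (sym (V-nat x (ℕ.<⇒≤ x<N)))))

    uniqueSolution : UniqueSolution m n π v
    uniqueSolution = tiling , (tiling-sl2 , tiling-pos , tiling-periodic , tiling-on-π) ,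
                     λ u sol → tiling-unique u (proj₁ sol) (solution-on-pathPoint u sol)

open import Data.Nat using (_+_)

proposition6p7 : (m n : ℕ) → 1 ≤ m → 1 ≤ n → (i j : ℤ) → (π : ℕ → Point) →
    IsLatticePath m n i j π → (v : ℕ → ℕ) → (∀ k → k ≤ m + n → 1 ≤ v k) →
    v 0 ≡ v (m + n) →
    ((∀ k → k ≤ m + n → v k ≡ 1) → UniqueSolution m n π v) ×
    (DivCondition m n π v → UniqueSolution m n π v)
proposition6p7 zero     _ ()  _   _ _ _ _    _ _     _
proposition6p7 (suc m′) n _ n≥1 i j π path v v-pos v-closed =
  (λ v≡1 → uniqueSolution (DivCondition-of-ones v≡1)) , uniqueSolution
  where open LatticePath m′ n n≥1 i j π path v v-pos v-closed
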